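{- Let $\Phi,\Psi$ be types with $\Phi\mathrel{S_T}\Psi$. (1) If $\circ\varphi$ is maximal in $\Phi^+$, then $\Phi\mathrel{S_T}(\Psi\setminus\circ\varphi)$. (2) If $\Diamond\varphi$ is maximal in $\Phi^+$ and $\varphi\in\Phi^+$, then $\Phi\mathrel{S_T}(\Psi\setminus\Diamond\varphi)$.
   Context: $\mathcal L_\Diamond$ is the language built from a countable set of propositional variables by $\varphi ::= \bot \mid p \mid \varphi\wedge\varphi \mid \varphi\vee\varphi\mid \varphi\to\varphi\mid \circ\varphi\mid\Diamond\varphi$. A (two-sided) type is a pair $\Phi=(\Phi^-;\Phi^+)$ of finite subsets of $\mathcal L_\Diamond$ such that: $\Phi^-\cap\Phi^+=\varnothing$; $\bot\notin\Phi^+$; if $\varphi\wedge\psi\in\Phi^+$ then $\varphi,\psi\in\Phi^+$; if $\varphi\wedge\psi\in\Phi^-$ then $\varphi\in\Phi^-$ or $\psi\in\Phi^-$; if $\varphi\vee\psi\in\Phi^+$ then $\varphi\in\Phi^+$ or $\psi\in\Phi^+$; if $\varphi\vee\psi\in\Phi^-$ then $\varphi,\psi\in\Phi^-$; if $\varphi\to\psi\in\Phi^+$ then $\varphi\in\Phi^-$ or $\psi\in\Phi^+$; if $\Diamond\varphi\in\Phi^-$ then $\varphi\in\Phi^-$. For pairs $\Phi,\Psi$ of sets of formulas, $\Phi\mathrel{S_T}\Psi$ iff for all $\theta$: if $\circ\theta\in\Phi^+$ then $\theta\in\Psi^+$; if $\circ\theta\in\Phi^-$ then $\theta\in\Psi^-$;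 if $\Diamond\theta\in\Phi^+$ then $\theta\in\Phi^+$ or $\Diamond\theta\in\Psi^+$; if $\Diamond\theta\in\Phi^-$ then $\Diamond\theta\in\Psi^-$. A temporal formula is one of the form $\circ\psi$ or $\Diamond\psi$. ${\rm sup}(\varphi)$ is the set of superformulas of $\varphi$ (formulas having $\varphi$ as a subformula). A formula $\varphi$ is maximal in a set $\Phi$ if $\varphi\in\Phi$ and no temporal formula in $\Phi$ other than $\varphi$ has $\varphi$ as a subformula. For a type $\Psi$, $\Psi\setminus\varphi=(\Psi^-;\Psi^+\setminus{\rm sup}(\varphi))$. -}

module Defs where

open import Data.Nat using (ℕ)
import Data.Nat as ℕ
open import Data.List using (List; filter)
open import Data.List.Membership.Propositional using (_∈_; _∉_)
open import Data.Product using (_×_; _,_; Σ; proj₁; proj₂)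
open import Data.Sum using (_⊎_; inj₁; inj₂)
open import Data.Empty using (⊥)
open import Relation.Nullary using (¬_; Dec; yes; no)
open import Relation.Nullary.Decidable using (_⊎-dec_; ¬?)
open import Relation.Binary.PropositionalEquality using (_≡_; refl; cong; cong₂)

data Formula : Set where
  falsum : Formula
  var    : ℕ → Formula
  _∧_    : Formula → Formula → Formula
  _∨_    : Formula → Formula → Formula
  _⇒_    : Formula → Formula → Formula
  ○_     : Formula → Formula
  ◇_     : Formula → Formula

_≟_ : (φ ψ : Formula) → Dec (φ ≡ ψ)
falsum ≟ falsum = yes refl
falsum ≟ var _ = no λ ()
falsum ≟ (_ ∧ _) = no λ ()
falsum ≟ (_ ∨ _) = no λ ()
falsum ≟ (_ ⇒ _) = no λ ()
falsum ≟ (○ _) = no λ ()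
falsum ≟ (◇ _) = no λ ()
var _ ≟ falsum = no λ ()
var m ≟ var n with m ℕ.≟ n
... | yes refl = yes refl
... | no ne = no λ { refl → ne refl }
var _ ≟ (_ ∧ _) = no λ ()
var _ ≟ (_ ∨ _) = no λ ()
var _ ≟ (_ ⇒ _) = no λ ()
var _ ≟ (○ _) = no λ ()
var _ ≟ (◇ _) = no λ ()
(_ ∧ _) ≟ falsum = no λ ()
(_ ∧ _) ≟ var _ = no λ ()
(a ∧ b) ≟ (c ∧ d) with a ≟ c | b ≟ d
... | yes refl | yes refl = yes refl
... | no ne | _ = no λ { refl → ne refl }
... | yes _ | no ne = no λ { refl → ne refl }
(_ ∧ _) ≟ (_ ∨ _) = no λ ()
(_ ∧ _) ≟ (_ ⇒ _) = no λ ()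
(_ ∧ _) ≟ (○ _) = no λ ()
(_ ∧ _) ≟ (◇ _) = no λ ()
(_ ∨ _) ≟ falsum = no λ ()
(_ ∨ _) ≟ var _ = no λ ()
(_ ∨ _) ≟ (_ ∧ _) = no λ ()
(a ∨ b) ≟ (c ∨ d) with a ≟ c | b ≟ d
... | yes refl | yes refl = yes refl
... | no ne | _ = no λ { refl → ne refl }
... | yes _ | no ne = no λ { refl → ne refl }
(_ ∨ _) ≟ (_ ⇒ _) = no λ ()
(_ ∨ _) ≟ (○ _) = no λ ()
(_ ∨ _) ≟ (◇ _) = no λ ()
(_ ⇒ _) ≟ falsum = no λ ()
(_ ⇒ _) ≟ var _ = no λ ()
(_ ⇒ _) ≟ (_ ∧ _) = no λ ()
(_ ⇒ _) ≟ (_ ∨ _) = no λ ()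
(a ⇒ b) ≟ (c ⇒ d) with a ≟ c | b ≟ d
... | yes refl | yes refl = yes refl
... | no ne | _ = no λ { refl → ne refl }
... | yes _ | no ne = no λ { refl → ne refl }
(_ ⇒ _) ≟ (○ _) = no λ ()
(_ ⇒ _) ≟ (◇ _) = no λ ()
(○ _) ≟ falsum = no λ ()
(○ _) ≟ var _ = no λ ()
(○ _) ≟ (_ ∧ _) = no λ ()
(○ _) ≟ (_ ∨ _) = no λ ()
(○ _) ≟ (_ ⇒ _) = no λ ()
(○ a) ≟ (○ b) with a ≟ b
... | yes refl = yes refl
... | no ne = no λ { refl → ne refl }
(○ _) ≟ (◇ _) = no λ ()
(◇ _) ≟ falsum = no λ ()
(◇ _) ≟ var _ = no λ ()
(◇ _) ≟ (_ ∧ _) = no λ ()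
(◇ _) ≟ (_ ∨ _) = no λ ()
(◇ _) ≟ (_ ⇒ _) = no λ ()
(◇ _) ≟ (○ _) = no λ ()
(◇ a) ≟ (◇ b) with a ≟ b
... | yes refl = yes refl
... | no ne = no λ { refl → ne refl }

data _⊑_ (φ : Formula) : Formula → Set where
  here : φ ⊑ φ
  ∧l : ∀ {a b} → φ ⊑ a → φ ⊑ (a ∧ b)
  ∧r : ∀ {a b} → φ ⊑ b → φ ⊑ (a ∧ b)
  ∨l : ∀ {a b} → φ ⊑ a → φ ⊑ (a ∨ b)
  ∨r : ∀ {a b} → φ ⊑ b → φ ⊑ (a ∨ b)
  ⇒l : ∀ {a b} → φ ⊑ a → φ ⊑ (a ⇒ b)
  ⇒r : ∀ {a b} → φ ⊑ b → φ ⊑ (a ⇒ b)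
  ○i : ∀ {a} → φ ⊑ a → φ ⊑ (○ a)
  ◇i : ∀ {a} → φ ⊑ a → φ ⊑ (◇ a)


_⊑?_ : (φ ψ : Formula) → Dec (φ ⊑ ψ)
φ ⊑? ψ with φ ≟ ψ
... | yes refl = yes here
φ ⊑? falsum | no ne = no λ { here → ne refl }
φ ⊑? var n | no ne = no λ { here → ne refl }
φ ⊑? (a ∧ b) | no ne with φ ⊑? a | φ ⊑? b
... | yes p | _ = yes (∧l p)
... | no _ | yes q = yes (∧r q)
... | no np | no nq = no λ { here → ne refl ; (∧l p) → np p ; (∧r q) → nq q }
φ ⊑? (a ∨ b) | no ne with φ ⊑? a | φ ⊑? b
... | yes p | _ = yes (∨l p)
... | no _ | yes q = yes (∨r q)
... | no np | no nq = no λ { here → ne refl ; (∨l p) → np p ; (∨r q) → nq q }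
φ ⊑? (a ⇒ b) | no ne with φ ⊑? a | φ ⊑? b
... | yes p | _ = yes (⇒l p)
... | no _ | yes q = yes (⇒r q)
... | no np | no nq = no λ { here → ne refl ; (⇒l p) → np p ; (⇒r q) → nq q }
φ ⊑? (○ a) | no ne with φ ⊑? a
... | yes p = yes (○i p)
... | no np = no λ { here → ne refl ; (○i p) → np p }
φ ⊑? (◇ a) | no ne with φ ⊑? a
... | yes p = yes (◇i p)
... | no np = no λ { here → ne refl ; (◇i p) → np p }

-- Pairs of finite sets of formulas, represented by lists (Φ⁻ ; Φ⁺)
record Pair : Set where
  constructor ⟨_⨾_⟩
  field
    neg : List Formula
    pos : List Formula
open Pair public

record IsType (Φ : Pair) : Set where
  field
    disjoint : ∀ {φ} → φ ∈ neg Φ → φ ∉ pos Φ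
    ⊥∉pos    : falsum ∉ pos Φ
    ∧pos     : ∀ {a b} → (a ∧ b) ∈ pos Φ → a ∈ pos Φ × b ∈ pos Φ
    ∧neg     : ∀ {a b} → (a ∧ b) ∈ neg Φ → a ∈ neg Φ ⊎ b ∈ neg Φ
    ∨pos     : ∀ {a b} → (a ∨ b) ∈ pos Φ → a ∈ pos Φ ⊎ b ∈ pos Φ
    ∨neg     : ∀ {a b} → (a ∨ b) ∈ neg Φ → a ∈ neg Φ × b ∈ neg Φ
    ⇒pos     : ∀ {a b} → (a ⇒ b) ∈ pos Φ → a ∈ neg Φ ⊎ b ∈ pos Φ
    ◇neg     : ∀ {a} → (◇ a) ∈ neg Φ → a ∈ neg Φ

record _Sₜ_ (Φ Ψ : Pair) : Set where
  field
    ○pos : ∀ {θ} → (○ θ) ∈ pos Φ → θ ∈ pos Ψ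
    ○neg : ∀ {θ} → (○ θ) ∈ neg Φ → θ ∈ neg Ψ
    ◇pos : ∀ {θ} → (◇ θ) ∈ pos Φ → θ ∈ pos Φ ⊎ (◇ θ) ∈ pos Ψ
    ◇neg : ∀ {θ} → (◇ θ) ∈ neg Φ → (◇ θ) ∈ neg Ψ

data Temporal : Formula → Set where
  ○t : ∀ {a} → Temporal (○ a)
  ◇t : ∀ {a} → Temporal (◇ a)

Maximal : Formula → List Formula → Set
Maximal φ X = φ ∈ X × (∀ {ψ} → ψ ∈ X → Temporal ψ → ¬ (ψ ≡ φ) → ¬ (φ ⊑ ψ))

_∖_ : Pair → Formula → Pair
Ψ ∖ φ = ⟨ neg Ψ ⨾ filter (λ ψ → ¬? (φ ⊑? ψ)) (pos Ψ) ⟩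

module Submission where

-- Shrinking the successor Ψ to Ψ ∖ χ leaves Ψ⁻ untouched and only
-- deletes from Ψ⁺ the superformulas of χ, so the clauses of S_T about Φ⁻ survive
-- unchanged.  The positive clauses survive as long as no formula that S_T forces
-- into Ψ⁺ is a superformula of χ: these are the θ with ○θ ∈ Φ⁺, and the ◇θ with
-- ◇θ ∈ Φ⁺ whose obligation is not already met by θ ∈ Φ⁺ (lemma Sₜ-∖).
--   For χ = ○φ or χ = ◇φ maximal in Φ⁺ these side conditions follow from
-- maximality: a forced formula that is a superformula of χ would give a temporal
-- formula of Φ⁺ strictly above χ, unless it coincides with χ itself.  The only
-- coincidences are θ = φ, which is impossible for ○φ because a formula never
-- contains ○φ or ◇φ as a proper part (lemmas ○-⋢ and ◇-⋢), and ◇θ = ◇φ, where the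
-- hypothesis φ ∈ Φ⁺ discharges the obligation.

open import Defs
open import Data.Product using (_×_; _,_)
open import Data.Sum using (_⊎_; inj₁; inj₂)
open import Data.List.Membership.Propositional using (_∈_)
open import Data.List.Membership.Propositional.Properties using (∈-filter⁺)
open import Data.Nat using (ℕ; suc; _+_; _≤_)
open import Data.Nat.Properties using (≤-trans; ≤-refl; m≤m+n; m≤n+m; n≤1+n; 1+n≰n)
open import Relation.Nullary using (¬_; yes; no)
open import Relation.Nullary.Decidable using (¬?)
open import Relation.Binary.PropositionalEquality using (_≡_; refl)

-- Number of symbols of a formula; it strictly grows along proper subformulas.
size : Formula → ℕ
size falsum  = 1
size (var _) = 1
size (a ∧ b) = suc (size a + size b)
size (a ∨ b) = suc (size a + size b)
size (a ⇒ b) = suc (size a + size b)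
size (○ a)   = suc (size a)
size (◇ a)   = suc (size a)

left≤ : ∀ m n → m ≤ suc (m + n)
left≤ m n = ≤-trans (m≤m+n m n) (n≤1+n _)

right≤ : ∀ m n → n ≤ suc (m + n)
right≤ m n = ≤-trans (m≤n+m n m) (n≤1+n _)

⊑-size : ∀ {χ ψ} → χ ⊑ ψ → size χ ≤ size ψ
⊑-size here           = ≤-refl
⊑-size (∧l {a} {b} p) = ≤-trans (⊑-size p) (left≤ (size a) (size b))
⊑-size (∧r {a} {b} p) = ≤-trans (⊑-size p) (right≤ (size a) (size b))
⊑-size (∨l {a} {b} p) = ≤-trans (⊑-size p) (left≤ (size a) (size b))
⊑-size (∨r {a} {b} p) = ≤-trans (⊑-size p) (right≤ (size a) (size b))
⊑-size (⇒l {a} {b} p) = ≤-trans (⊑-size p) (left≤ (size a) (size b))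
⊑-size (⇒r {a} {b} p) = ≤-trans (⊑-size p) (right≤ (size a) (size b))
⊑-size (○i p)         = ≤-trans (⊑-size p) (n≤1+n _)
⊑-size (◇i p)         = ≤-trans (⊑-size p) (n≤1+n _)

○-⋢ : ∀ {φ} → ¬ ((○ φ) ⊑ φ)
○-⋢ p = 1+n≰n (⊑-size p)

◇-⋢ : ∀ {φ} → ¬ ((◇ φ) ⊑ φ)
◇-⋢ p = 1+n≰n (⊑-size p)

∈-∖ : ∀ {Ψ χ ψ} → ψ ∈ pos Ψ → ¬ (χ ⊑ ψ) → ψ ∈ pos (Ψ ∖ χ)
∈-∖ {χ = χ} ψ∈Ψ χ⋢ψ = ∈-filter⁺ (λ ψ → ¬? (χ ⊑? ψ)) ψ∈Ψ χ⋢ψ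

Sₜ-∖ : ∀ {Φ Ψ} χ → Φ Sₜ Ψ
  → (∀ {θ} → (○ θ) ∈ pos Φ → ¬ (χ ⊑ θ))
  → (∀ {θ} → (◇ θ) ∈ pos Φ → θ ∈ pos Φ ⊎ ¬ (χ ⊑ (◇ θ)))
  → Φ Sₜ (Ψ ∖ χ)
Sₜ-∖ {Φ} {Ψ} χ S ○-free ◇-free = record
  { ○pos = λ ○θ∈Φ → ∈-∖ {Ψ} (S.○pos ○θ∈Φ) (○-free ○θ∈Φ)
  ; ○neg = S.○neg
  ; ◇pos = λ ◇θ∈Φ → ◇-obligation (◇-free ◇θ∈Φ) (S.◇pos ◇θ∈Φ)
  ; ◇neg = S.◇neg
  }
  where
  module S = _Sₜ_ S
  ◇-obligation : ∀ {θ} → θ ∈ pos Φ ⊎ ¬ (χ ⊑ (◇ θ)) → θ ∈ pos Φ ⊎ (◇ θ) ∈ pos Ψ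
    → θ ∈ pos Φ ⊎ (◇ θ) ∈ pos (Ψ ∖ χ)
  ◇-obligation _          (inj₁ θ∈Φ)  = inj₁ θ∈Φ
  ◇-obligation (inj₁ θ∈Φ) (inj₂ _)    = inj₁ θ∈Φ
  ◇-obligation (inj₂ χ⋢◇θ) (inj₂ ◇θ∈Ψ) = inj₂ (∈-∖ {Ψ} ◇θ∈Ψ χ⋢◇θ)

lemma7p9 : (Φ Ψ : Pair) → IsType Φ → IsType Ψ → Φ Sₜ Ψ →
    (∀ φ → Maximal (○ φ) (pos Φ) → Φ Sₜ (Ψ ∖ (○ φ)))
    × (∀ φ → Maximal (◇ φ) (pos Φ) → φ ∈ pos Φ → Φ Sₜ (Ψ ∖ (◇ φ)))
lemma7p9 Φ Ψ _ _ S = next-maximal , eventually-maximal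
  where
  -- (1) ○θ ∈ Φ⁺ with ○φ ⊑ θ lies strictly above ○φ (θ = φ is impossible by ○-⋢);
  -- ◇θ is never equal to ○φ.
  next-maximal : ∀ φ → Maximal (○ φ) (pos Φ) → Φ Sₜ (Ψ ∖ (○ φ))
  next-maximal φ (_ , above) = Sₜ-∖ (○ φ) S
    (λ ○θ∈Φ ○φ⊑θ → above ○θ∈Φ ○t (λ { refl → ○-⋢ ○φ⊑θ }) (○i ○φ⊑θ))
    (λ ◇θ∈Φ → inj₂ (above ◇θ∈Φ ◇t (λ ())))

  -- (2) ○θ is never equal to ◇φ; ◇θ ∈ Φ⁺ is either ◇φ itself, whose obligation
  -- is met by φ ∈ Φ⁺, or is not above ◇φ by maximality.
  eventually-maximal : ∀ φ → Maximal (◇ φ) (pos Φ) → φ ∈ pos Φ → Φ Sₜ (Ψ ∖ (◇ φ))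
  eventually-maximal φ (_ , above) φ∈Φ = Sₜ-∖ (◇ φ) S
    (λ ○θ∈Φ ◇φ⊑θ → above ○θ∈Φ ○t (λ ()) (○i ◇φ⊑θ))
    ◇-free
    where
    ◇-free : ∀ {θ} → (◇ θ) ∈ pos Φ → θ ∈ pos Φ ⊎ ¬ ((◇ φ) ⊑ (◇ θ))
    ◇-free {θ} ◇θ∈Φ with θ ≟ φ
    ... | yes refl = inj₁ φ∈Φ
    ... | no θ≢φ   = inj₂ (above ◇θ∈Φ ◇t (λ { refl → θ≢φ refl }))
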